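{- Let $\pi,\tau$ be simple related chromosomes with $dp[\pi]=dp[\tau]=2$ and $\mathcal{A}[\pi]=\mathcal{A}[\tau]$. Then no single white vertex of weight 1 forms a connected component of the intersection graph $IG(\pi,\tau)$.
   Context: Fix genes $\Sigma_1$ and repeats $\Sigma_2\ni r_0$. A chromosome is a sequence $\pi=[x_0,\dots,x_{n+1}]$ of signed symbols ($x_i=\pm a$, $|x_i|=a$) with $x_0=+r_0$, $x_{n+1}=-r_0$, every gene occurring exactly once. $dp[a,\pi]$ is the number of occurrences of $a$, $dp[\pi]$ its maximum over repeats; related chromosomes have equal duplication numbers. Nodes: $(l(x_i),r(x_i))=(a^h,a^t)$ if $x_i=+a$, $(a^t,a^h)$ if $x_i=-a$. Adjacencies: unordered pairs $\langle r(x_i),l(x_{i+1})\rangle$, $0\le i\le n$, each associated with $x_i$ and $x_{i+1}$; $\mathcal{A}[\pi]$ is their multiset; $\pi$ is simple if no adjacency repeats. Neighbor-consistency: identical adjacencies of $\pi$ and $\tau$ are matched by the unique bijection (ends of $\pi$ regarded as matched to the corresponding ends of $\tau$). A repeat $x$ with occurrences $x_i,x_j$ in $\pi$ and $y_{i'},y_{j'}$ in $\tau$ is even (neighbor-consistent) if the left and right adjacencies of $x_i$ are matched to adjacencies both associated with $y_{i'}$ or both with $y_{j'}$, and odd otherwise. $IG(\pi,\tau)$: one vertex per repeat $x$ with $dp[x,\pi]=2$, of weight 2 if $x$ is even and 1 if odd, black if the two occurrences of $x$ in $\pi$ have different signs and white otherwise; $x,y$ adjacent iff their occurrences alternate in $\pi$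 (positions $i<j$ of $x$ and $k<l$ of $y$ satisfy $i<k<j<l$ or $k<i<l<j$). -}

module Defs where

open import Data.Nat using (ℕ; zero; suc; _<_; _⊔_)
open import Data.Fin using (Fin) renaming (zero to fzero)
import Data.Fin.Properties as FinP
open import Data.List using (List; []; _∷_; _++_; [_]; length; filter; map; foldr; allFin)
open import Data.Maybe using (Maybe; just; nothing)
open import Data.Product using (Σ; ∃; ∃-syntax; _×_; _,_; swap)
open import Data.Sum using (_⊎_; inj₁; inj₂)
open import Relation.Nullary using (Dec; yes; no; ¬_)
open import Relation.Nullary.Decidable using (map′; _⊎-dec_; _×-dec_)
open import Relation.Binary.PropositionalEquality using (_≡_; _≢_; refl; cong; cong₂)
open import Relation.Binary.Definitions using (DecidableEquality)

-- Alphabet: genes Σ₁ = Fin G, repeats Σ₂ = Fin (suc R), with r₀ = fzero.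

data Sym (G R : ℕ) : Set where
  gene : Fin G → Sym G R
  rep  : Fin (suc R) → Sym G R

data Sign : Set where
  plus minus : Sign

data End : Set where
  hd tl : End

SSym : ℕ → ℕ → Set
SSym G R = Sign × Sym G R

∣_∣ₛ : ∀ {G R} → SSym G R → Sym G R
∣ (_ , a) ∣ₛ = a

sign : ∀ {G R} → SSym G R → Sign
sign (s , _) = s

Chromosome : ℕ → ℕ → Set
Chromosome G R = List (SSym G R)

Node : ℕ → ℕ → Set
Node G R = Sym G R × End

l r : ∀ {G R} → SSym G R → Node G R
l (plus , a)  = (a , hd)
l (minus , a) = (a , tl)
r (plus , a)  = (a , tl)
r (minus , a) = (a , hd)

-- an adjacency ⟨u , v⟩ is an unordered pair; represented by an ordered
-- pair and compared up to swapping.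
Adjacency : ℕ → ℕ → Set
Adjacency G R = Node G R × Node G R

AdjEq : ∀ {G R} → Adjacency G R → Adjacency G R → Set
AdjEq a b = (a ≡ b) ⊎ (swap a ≡ b)

adjs : ∀ {G R} → Chromosome G R → List (Adjacency G R)
adjs []           = []
adjs (x ∷ [])     = []
adjs (x ∷ y ∷ xs) = (r x , l y) ∷ adjs (y ∷ xs)

sym-dec : ∀ {G R} → DecidableEquality (Sym G R)
sym-dec (gene a) (gene b) = map′ (cong gene) (λ { refl → refl }) (a FinP.≟ b)
sym-dec (gene a) (rep b)  = no λ ()
sym-dec (rep a)  (gene b) = no λ ()
sym-dec (rep a)  (rep b)  = map′ (cong rep) (λ { refl → refl }) (a FinP.≟ b)

end-dec : DecidableEquality End
end-dec hd hd = yes refl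
end-dec hd tl = no λ ()
end-dec tl hd = no λ ()
end-dec tl tl = yes refl

node-dec : ∀ {G R} → DecidableEquality (Node G R)
node-dec (a , e) (b , f) =
  map′ (λ { (refl , refl) → refl }) (λ { refl → refl , refl }) (sym-dec a b ×-dec end-dec e f)

adj-dec : ∀ {G R} → DecidableEquality (Adjacency G R)
adj-dec (u , v) (u' , v') =
  map′ (λ { (refl , refl) → refl }) (λ { refl → refl , refl }) (node-dec u u' ×-dec node-dec v v')

adjEq-dec : ∀ {G R} (a b : Adjacency G R) → Dec (AdjEq a b)
adjEq-dec a b = adj-dec a b ⊎-dec adj-dec (swap a) b

_‼_ : ∀ {A : Set} → List A → ℕ → Maybe A
[]       ‼ _     = nothing
(x ∷ xs) ‼ zero  = just x
(x ∷ xs) ‼ suc n = xs ‼ n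

Occ : ∀ {G R} → Chromosome G R → ℕ → Sym G R → Set
Occ π p a = ∃[ s ] (π ‼ p ≡ just s × ∣ s ∣ₛ ≡ a)

dp : ∀ {G R} → Sym G R → Chromosome G R → ℕ
dp a π = length (filter (λ s → sym-dec ∣ s ∣ₛ a) π)

dpMax : ∀ {G R} → Chromosome G R → ℕ
dpMax {G} {R} π = foldr _⊔_ 0 (map (λ x → dp (rep x) π) (allFin (suc R)))

mult : ∀ {G R} → Adjacency G R → Chromosome G R → ℕ
mult a π = length (filter (adjEq-dec a) (adjs π))

r₀ : ∀ {G R} → Sym G R
r₀ = rep fzero

IsChromosome : ∀ {G R} → Chromosome G R → Set
IsChromosome {G} π =
  (∃[ mid ] π ≡ (plus , r₀) ∷ (mid ++ [ (minus , r₀) ]))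
  × (∀ (g : Fin G) → dp (gene g) π ≡ 1)

Related : ∀ {G R} → Chromosome G R → Chromosome G R → Set
Related π τ = ∀ a → dp a π ≡ dp a τ

SameAdjacencies : ∀ {G R} → Chromosome G R → Chromosome G R → Set
SameAdjacencies π τ = ∀ a → mult a π ≡ mult a τ

Simple : ∀ {G R} → Chromosome G R → Set
Simple π = ∀ k k' a b → adjs π ‼ k ≡ just a → adjs π ‼ k' ≡ just b → AdjEq a b → k ≡ k'

-- The left adjacency of position p of π (adjacency p-1, or the left end
-- if p = 0) is matched to an adjacency (resp. end) of τ associated with
-- position q of τ.
LeftMatchedTo : ∀ {G R} → Chromosome G R → Chromosome G R → ℕ → ℕ → Set
LeftMatchedTo π τ p q =
  (p ≡ 0 × q ≡ 0)
  ⊎ (∃[ p₀ ] ∃[ k ] ∃[ a ] ∃[ b ]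
       (p ≡ suc p₀ × adjs π ‼ p₀ ≡ just a × adjs τ ‼ k ≡ just b × AdjEq a b
        × (q ≡ k ⊎ q ≡ suc k)))

RightMatchedTo : ∀ {G R} → Chromosome G R → Chromosome G R → ℕ → ℕ → Set
RightMatchedTo π τ p q =
  (suc p ≡ length π × suc q ≡ length τ)
  ⊎ (∃[ k ] ∃[ a ] ∃[ b ]
       (adjs π ‼ p ≡ just a × adjs τ ‼ k ≡ just b × AdjEq a b
        × (q ≡ k ⊎ q ≡ suc k)))

EvenAt : ∀ {G R} → Chromosome G R → Chromosome G R → ℕ → ℕ → ℕ → Set
EvenAt π τ i i' j' =
  (LeftMatchedTo π τ i i' × RightMatchedTo π τ i i')
  ⊎ (LeftMatchedTo π τ i j' × RightMatchedTo π τ i j')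

Odd : ∀ {G R} → Chromosome G R → Chromosome G R → Fin (suc R) → Set
Odd π τ x = ∀ i j i' j' → i < j → Occ π i (rep x) → Occ π j (rep x)
  → i' < j' → Occ τ i' (rep x) → Occ τ j' (rep x) → ¬ EvenAt π τ i i' j'

IsVertex : ∀ {G R} → Chromosome G R → Fin (suc R) → Set
IsVertex π x = dp (rep x) π ≡ 2

White : ∀ {G R} → Chromosome G R → Fin (suc R) → Set
White π x = ∀ i j s t → i < j → π ‼ i ≡ just s → π ‼ j ≡ just t
  → ∣ s ∣ₛ ≡ rep x → ∣ t ∣ₛ ≡ rep x → sign s ≡ sign t

Weight1 : ∀ {G R} → Chromosome G R → Chromosome G R → Fin (suc R) → Set
Weight1 = Odd

IGAdj : ∀ {G R} → Chromosome G R → Fin (suc R) → Fin (suc R) → Set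
IGAdj π x y = ∃[ i ] ∃[ j ] ∃[ k ] ∃[ m ]
  (Occ π i (rep x) × Occ π j (rep x) × Occ π k (rep y) × Occ π m (rep y)
   × i < j × k < m
   × ((i < k × k < j × j < m) ⊎ (k < i × i < m × m < j)))

-- Let the white repeat x occur at positions i < j of π, both times as the same signed
-- symbol sx. A symbol occurring both strictly between i and j and outside [i, j] is a
-- repeat alternating with x. Otherwise every node of the block π[i..j] other than r(sx)
-- and l(sx) belongs to a symbol all of whose occurrences lie inside the block. Start in τ
-- at the adjacency equal to the right adjacency ⟨r(sx), l(π_{i+1})⟩ of x_i and walk away
-- from the copy of x carrying r(sx): every adjacency met equals one of the block, so the
-- walk ends at the node l(sx), carried by the other copy of x in τ. The left adjacency of
-- x_i also contains l(sx), and simplicity of π keeps it away from that other copy. Hence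
-- both adjacencies of x_i are matched next to the same copy of x in τ: x is even, not of
-- weight 1.
module Submission where

open import Defs
open import Data.Nat using (ℕ; zero; suc; pred; ≢-nonZero; _<_; _≤_; _⊔_; _+_; z≤n; s≤s)
open import Data.Nat.Properties
open import Data.Fin using (Fin)
open import Data.List using (List; []; _∷_; _++_; [_]; length; filter; foldr)
open import Data.List.Membership.Propositional using (_∈_)
open import Data.List.Membership.Propositional.Properties using (∈-allFin; ∈-map⁺)
open import Data.List.Relation.Unary.Any using (here; there)
open import Data.Maybe using (Maybe; just; nothing)
open import Data.Maybe.Properties using (just-injective)
open import Data.Product using (∃-syntax; _×_; _,_; proj₁; proj₂)
open import Data.Sum using (_⊎_; inj₁; inj₂)
import Data.Sum as Sum
open import Data.Empty using (⊥; ⊥-elim)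
open import Relation.Nullary using (Dec; yes; no; ¬_)
open import Relation.Nullary.Decidable using (map′; _×-dec_; _⊎-dec_)
open import Relation.Unary using (Decidable)
open import Relation.Binary.Definitions using (tri<; tri≈; tri>)
open import Relation.Binary.PropositionalEquality using (_≡_; _≢_; refl; sym; trans; cong; subst)

‼-unique : ∀ {A : Set} (xs : List A) {p a b} → xs ‼ p ≡ just a → xs ‼ p ≡ just b → a ≡ b
‼-unique _ e₁ e₂ = just-injective (trans (sym e₁) e₂)

‼⇒<length : ∀ {A : Set} (xs : List A) {k u} → xs ‼ k ≡ just u → k < length xs
‼⇒<length (x ∷ xs) {zero}  _ = s≤s z≤n
‼⇒<length (x ∷ xs) {suc k} e = s≤s (‼⇒<length xs e)

‼-defined-≤ : ∀ {A : Set} (xs : List A) {k m u} → xs ‼ k ≡ just u → m ≤ k → ∃[ w ] (xs ‼ m ≡ just w)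
‼-defined-≤ (x ∷ xs) {m = zero}  _ _ = x , refl
‼-defined-≤ (x ∷ xs) {suc k} {suc m} e (s≤s m≤k) = ‼-defined-≤ xs e m≤k

‼-length-snoc : ∀ {A : Set} (ys : List A) (e : A) → (ys ++ [ e ]) ‼ length ys ≡ just e
‼-length-snoc []       e = refl
‼-length-snoc (y ∷ ys) e = ‼-length-snoc ys e

‼-last-snoc : ∀ {A : Set} (ys : List A) {e t : A} q → (ys ++ [ e ]) ‼ q ≡ just t
            → (ys ++ [ e ]) ‼ suc q ≡ nothing → t ≡ e
‼-last-snoc []           zero    refl _ = refl
‼-last-snoc (_ ∷ [])     zero    _    ()
‼-last-snoc (_ ∷ _ ∷ _)  zero    _    ()
‼-last-snoc (_ ∷ ys)     (suc q) h₁   h₂ = ‼-last-snoc ys q h₁ h₂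

module _ {A : Set} {P : A → Set} (P? : Decidable P) where

  1≤length-filter : ∀ xs {p u} → xs ‼ p ≡ just u → P u → 1 ≤ length (filter P? xs)
  1≤length-filter (x ∷ xs) {zero} refl pu with P? x
  ... | yes _  = s≤s z≤n
  ... | no ¬px = ⊥-elim (¬px pu)
  1≤length-filter (x ∷ xs) {suc p} e pu with P? x
  ... | yes _ = s≤s z≤n
  ... | no _  = 1≤length-filter xs e pu

  2≤length-filter : ∀ xs {p q u v} → p < q → xs ‼ p ≡ just u → P u → xs ‼ q ≡ just v → P v
                  → 2 ≤ length (filter P? xs)
  2≤length-filter (x ∷ xs) {zero} {suc q} _ refl pu e pv with P? x
  ... | yes _  = s≤s (1≤length-filter xs e pv)
  ... | no ¬px = ⊥-elim (¬px pu)
  2≤length-filter (x ∷ xs) {suc p} {suc q} (s≤s p<q) e₁ pu e₂ pv with P? x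
  ... | yes _ = m≤n⇒m≤1+n (2≤length-filter xs p<q e₁ pu e₂ pv)
  ... | no _  = 2≤length-filter xs p<q e₁ pu e₂ pv

  3≤length-filter : ∀ xs {p q s u v w} → p < q → q < s → xs ‼ p ≡ just u → P u
                  → xs ‼ q ≡ just v → P v → xs ‼ s ≡ just w → P w → 3 ≤ length (filter P? xs)
  3≤length-filter (x ∷ xs) {zero} {suc q} {suc s} _ (s≤s q<s) refl pu e₂ pv e₃ pw with P? x
  ... | yes _  = s≤s (2≤length-filter xs q<s e₂ pv e₃ pw)
  ... | no ¬px = ⊥-elim (¬px pu)
  3≤length-filter (x ∷ xs) {suc p} {suc q} {suc s} (s≤s p<q) (s≤s q<s) e₁ pu e₂ pv e₃ pw with P? x
  ... | yes _ = m≤n⇒m≤1+n (3≤length-filter xs p<q q<s e₁ pu e₂ pv e₃ pw)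
  ... | no _  = 3≤length-filter xs p<q q<s e₁ pu e₂ pv e₃ pw

  1≤length-filter⇒∃ : ∀ xs → 1 ≤ length (filter P? xs) → ∃[ p ] ∃[ u ] (xs ‼ p ≡ just u × P u)
  1≤length-filter⇒∃ (x ∷ xs) h with P? x
  ... | yes px = 0 , x , refl , px
  ... | no _ with 1≤length-filter⇒∃ xs h
  ...   | p , u , e , pu = suc p , u , e , pu

  2≤length-filter⇒∃ : ∀ xs → 2 ≤ length (filter P? xs)
                    → ∃[ p ] ∃[ q ] ∃[ u ] ∃[ v ] (p < q × xs ‼ p ≡ just u × P u × xs ‼ q ≡ just v × P v)
  2≤length-filter⇒∃ (x ∷ xs) h with P? x
  2≤length-filter⇒∃ (x ∷ xs) (s≤s h) | yes px with 1≤length-filter⇒∃ xs h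
  ... | q , v , e , pv = 0 , suc q , x , v , s≤s z≤n , refl , px , e , pv
  2≤length-filter⇒∃ (x ∷ xs) h | no _ with 2≤length-filter⇒∃ xs h
  ... | p , q , u , v , p<q , e₁ , pu , e₂ , pv = suc p , suc q , u , v , s≤s p<q , e₁ , pu , e₂ , pv

≤-foldr-⊔ : ∀ {n} (xs : List ℕ) → n ∈ xs → n ≤ foldr _⊔_ 0 xs
≤-foldr-⊔ (x ∷ xs) (here refl) = m≤m⊔n x _
≤-foldr-⊔ (x ∷ xs) (there n∈xs) = ≤-trans (≤-foldr-⊔ xs n∈xs) (m≤n⊔m x _)

module _ {G R : ℕ} where

  l-symbol : (t : SSym G R) → proj₁ (l t) ≡ ∣ t ∣ₛ
  l-symbol (plus , a)  = refl
  l-symbol (minus , a) = refl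

  r-symbol : (t : SSym G R) → proj₁ (r t) ≡ ∣ t ∣ₛ
  r-symbol (plus , a)  = refl
  r-symbol (minus , a) = refl

  l-r-symbol : (t : SSym G R) → proj₁ (l t) ≡ proj₁ (r t)
  l-r-symbol (plus , a)  = refl
  l-r-symbol (minus , a) = refl

  l≢r : (t : SSym G R) → l t ≢ r t
  l≢r (plus , a)  ()
  l≢r (minus , a) ()

  sign-symbol-injective : {u v : SSym G R} → sign u ≡ sign v → ∣ u ∣ₛ ≡ ∣ v ∣ₛ → u ≡ v
  sign-symbol-injective refl refl = refl

  adjEq-sym : {a b : Adjacency G R} → AdjEq a b → AdjEq b a
  adjEq-sym (inj₁ refl) = inj₁ refl
  adjEq-sym (inj₂ refl) = inj₂ refl

  adjEq-trans : {a b c : Adjacency G R} → AdjEq a b → AdjEq b c → AdjEq a c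
  adjEq-trans (inj₁ refl) q           = q
  adjEq-trans (inj₂ refl) (inj₁ refl) = inj₂ refl
  adjEq-trans (inj₂ refl) (inj₂ refl) = inj₁ refl

  adjEq-loop : {n₁ n₂ m₁ m₂ : Node G R}
             → AdjEq (n₁ , n₂) (m₁ , m₂) → m₁ ≡ n₁ → m₂ ≡ n₁ → n₂ ≡ n₁
  adjEq-loop (inj₁ refl) _ e = e
  adjEq-loop (inj₂ refl) e _ = e

  Endpoint : Adjacency G R → Node G R → Set
  Endpoint (n₁ , n₂) n = n ≡ n₁ ⊎ n ≡ n₂

  adjEq-endpoint : {a b : Adjacency G R} {n : Node G R} → AdjEq a b → Endpoint a n → Endpoint b n
  adjEq-endpoint (inj₁ refl) e        = e
  adjEq-endpoint (inj₂ refl) (inj₁ e) = inj₂ e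
  adjEq-endpoint (inj₂ refl) (inj₂ e) = inj₁ e

  adjs-‼ : (σ : Chromosome G R) {k : ℕ} {u t : SSym G R} → σ ‼ k ≡ just u → σ ‼ suc k ≡ just t
         → adjs σ ‼ k ≡ just (r u , l t)
  adjs-‼ (x ∷ y ∷ xs) {zero}  refl refl = refl
  adjs-‼ (x ∷ y ∷ xs) {suc k} e₁   e₂   = adjs-‼ (y ∷ xs) e₁ e₂
  adjs-‼ (x ∷ [])     {zero}  _    ()

  adjs-‼⁻ : (σ : Chromosome G R) {k : ℕ} {a : Adjacency G R} → adjs σ ‼ k ≡ just a
          → ∃[ u ] ∃[ t ] (σ ‼ k ≡ just u × σ ‼ suc k ≡ just t × a ≡ (r u , l t))
  adjs-‼⁻ (x ∷ y ∷ xs) {zero}  refl = x , y , refl , refl , refl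
  adjs-‼⁻ (x ∷ y ∷ xs) {suc k} e    = adjs-‼⁻ (y ∷ xs) e

  -- The node n of the k-th adjacency ⟨r(σ_k), l(σ_{k+1})⟩ of σ is an extremity of the
  -- occurrence σ_q.
  data NodeAt (σ : Chromosome G R) (k : ℕ) (n : Node G R) : ℕ → Set where
    r-node : ∀ {u t} → σ ‼ k ≡ just u → σ ‼ suc k ≡ just t → n ≡ r u → NodeAt σ k n k
    l-node : ∀ {u t} → σ ‼ k ≡ just u → σ ‼ suc k ≡ just t → n ≡ l t → NodeAt σ k n (suc k)

  module _ {σ : Chromosome G R} {k q : ℕ} {n : Node G R} where

    nodeAt-position : NodeAt σ k n q → q ≡ k ⊎ q ≡ suc k
    nodeAt-position (r-node _ _ _) = inj₁ refl
    nodeAt-position (l-node _ _ _) = inj₂ refl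

    nodeAt-occ : NodeAt σ k n q → Occ σ q (proj₁ n)
    nodeAt-occ (r-node {u} σk _ refl) = u , σk , sym (r-symbol u)
    nodeAt-occ (l-node {t = t} _ σsk refl) = t , σsk , sym (l-symbol t)

    nodeAt⇒endpoint : NodeAt σ k n q → ∃[ a ] (adjs σ ‼ k ≡ just a × Endpoint a n)
    nodeAt⇒endpoint (r-node σk σsk e) = _ , adjs-‼ σ σk σsk , inj₁ e
    nodeAt⇒endpoint (l-node σk σsk e) = _ , adjs-‼ σ σk σsk , inj₂ e

  endpoint⇒nodeAt : (σ : Chromosome G R) {k : ℕ} {n : Node G R} {a : Adjacency G R}
                  → adjs σ ‼ k ≡ just a → Endpoint a n → ∃[ q ] NodeAt σ k n q
  endpoint⇒nodeAt σ {k} σk en with adjs-‼⁻ σ σk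
  ... | u , t , σk , σsk , refl with en
  ...   | inj₁ e = k , r-node σk σsk e
  ...   | inj₂ e = suc k , l-node σk σsk e

  nodeAt-unique-adjacency : {σ : Chromosome G R} {k k' q : ℕ} {n : Node G R}
                          → NodeAt σ k n q → NodeAt σ k' n q → k ≡ k'
  nodeAt-unique-adjacency (r-node _ _ _) (r-node _ _ _) = refl
  nodeAt-unique-adjacency (l-node _ _ _) (l-node _ _ _) = refl
  nodeAt-unique-adjacency {σ} (r-node {u} σk _ refl) (l-node _ σk' e) with ‼-unique σ σk σk'
  ... | refl = ⊥-elim (l≢r u (sym e))
  nodeAt-unique-adjacency {σ} (l-node {t = t} _ σsk refl) (r-node σsk' _ e) with ‼-unique σ σsk σsk'
  ... | refl = ⊥-elim (l≢r t e)

  nodeAt-transfer : {σ σ' : Chromosome G R} {k k' q : ℕ} {n : Node G R} {a b : Adjacency G R}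
                  → adjs σ ‼ k ≡ just a → adjs σ' ‼ k' ≡ just b → AdjEq a b
                  → NodeAt σ k n q → ∃[ q' ] NodeAt σ' k' n q'
  nodeAt-transfer {σ} {σ'} σk σ'k' a≈b nd with nodeAt⇒endpoint nd
  ... | _ , σk₂ , en with ‼-unique (adjs σ) σk σk₂
  ...   | refl = endpoint⇒nodeAt σ' σ'k' (adjEq-endpoint a≈b en)

  data Matched (π τ : Chromosome G R) (c k : ℕ) : Set where
    matched : ∀ {a b} → adjs π ‼ c ≡ just a → adjs τ ‼ k ≡ just b → AdjEq a b → Matched π τ c k

  module _ {π τ : Chromosome G R} where

    matched-nodeAt : ∀ {c k q n} → Matched π τ c k → NodeAt π c n q → ∃[ q' ] NodeAt τ k n q'
    matched-nodeAt (matched πc τk a≈b) = nodeAt-transfer πc τk a≈b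

    matched-nodeAt⁻ : ∀ {c k q n} → Matched π τ c k → NodeAt τ k n q → ∃[ q' ] NodeAt π c n q'
    matched-nodeAt⁻ (matched πc τk a≈b) = nodeAt-transfer τk πc (adjEq-sym a≈b)

    matched-injectiveʳ : Simple τ → ∀ {c k k'} → Matched π τ c k → Matched π τ c k' → k ≡ k'
    matched-injectiveʳ sτ (matched πc τk a≈b) (matched πc' τk' a≈b') with ‼-unique (adjs π) πc πc'
    ... | refl = sτ _ _ _ _ τk τk' (adjEq-trans (adjEq-sym a≈b) a≈b')

    matched-injectiveˡ : Simple π → ∀ {c c' k} → Matched π τ c k → Matched π τ c' k → c ≡ c'
    matched-injectiveˡ sπ (matched πc τk a≈b) (matched πc' τk' a≈b') with ‼-unique (adjs τ) τk τk'
    ... | refl = sπ _ _ _ _ πc πc' (adjEq-trans a≈b (adjEq-sym a≈b'))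

    module _ (same : SameAdjacencies π τ) where

      sameAdjacencies⇒matchedʳ : ∀ {c a} → adjs π ‼ c ≡ just a → ∃[ k ] Matched π τ c k
      sameAdjacencies⇒matchedʳ {c} {a} πc
        with 1≤length-filter⇒∃ (adjEq-dec a) (adjs τ)
               (subst (1 ≤_) (same a) (1≤length-filter (adjEq-dec a) (adjs π) πc (inj₁ refl)))
      ... | k , b , τk , a≈b = k , matched πc τk a≈b

      sameAdjacencies⇒matchedˡ : ∀ {k b} → adjs τ ‼ k ≡ just b → ∃[ c ] Matched π τ c k
      sameAdjacencies⇒matchedˡ {k} {b} τk
        with 1≤length-filter⇒∃ (adjEq-dec b) (adjs π)
               (subst (1 ≤_) (sym (same b)) (1≤length-filter (adjEq-dec b) (adjs τ) τk (inj₁ refl)))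
      ... | c , a , πc , b≈a = c , matched πc τk (adjEq-sym b≈a)

  module _ {σ : Chromosome G R} where

    chromosome-head : IsChromosome σ → σ ‼ 0 ≡ just (plus , r₀)
    chromosome-head ((_ , refl) , _) = refl

    chromosome-last : IsChromosome σ → ∃[ L ] (0 < L × σ ‼ L ≡ just (minus , r₀))
    chromosome-last ((mid , refl) , _) = suc (length mid) , s≤s z≤n , ‼-length-snoc mid _

    chromosome-end : IsChromosome σ → ∀ {q t} → σ ‼ q ≡ just t → σ ‼ suc q ≡ nothing → t ≡ (minus , r₀)
    chromosome-end ((mid , refl) , _) {q} = ‼-last-snoc ((plus , r₀) ∷ mid) q

    dp≤dpMax : ∀ y → dp (rep y) σ ≤ dpMax σ
    dp≤dpMax y = ≤-foldr-⊔ _ (∈-map⁺ (λ x → dp (rep x) σ) (∈-allFin y))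

    twice⇒vertex : IsChromosome σ → dpMax σ ≡ 2 → ∀ {a p q} → p < q → Occ σ p a → Occ σ q a
                 → ∃[ y ] (a ≡ rep y × IsVertex σ y)
    twice⇒vertex cσ _ {gene g} p<q (_ , σp , pu) (_ , σq , qv) =
      ⊥-elim (1+n≰n (subst (2 ≤_) (proj₂ cσ g)
        (2≤length-filter (λ s → sym-dec ∣ s ∣ₛ (gene g)) σ p<q σp pu σq qv)))
    twice⇒vertex _ max≡2 {rep y} p<q (_ , σp , pu) (_ , σq , qv) =
      y , refl , ≤-antisym (subst (dp (rep y) σ ≤_) max≡2 (dp≤dpMax y))
                           (2≤length-filter (λ s → sym-dec ∣ s ∣ₛ (rep y)) σ p<q σp pu σq qv)

  dp≡2⇒no-third : (σ : Chromosome G R) {a : Sym G R} {p q s : ℕ} → dp a σ ≡ 2 → p < q → q < s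
                → Occ σ p a → Occ σ q a → Occ σ s a → ⊥
  dp≡2⇒no-third σ {a} dp≡2 p<q q<s (_ , σp , pa) (_ , σq , qa) (_ , σs , sa) =
    1+n≰n (subst (3 ≤_) dp≡2 (3≤length-filter (λ z → sym-dec ∣ z ∣ₛ a) σ p<q q<s σp pa σq qa σs sa))

  dp≡2-positions : (σ : Chromosome G R) {a : Sym G R} {p q s : ℕ} → dp a σ ≡ 2 → p < q
                 → Occ σ p a → Occ σ q a → Occ σ s a → s ≡ p ⊎ s ≡ q
  dp≡2-positions σ {p = p} {q} {s} dp≡2 p<q op oq os with <-cmp s p
  ... | tri< s<p _ _ = ⊥-elim (dp≡2⇒no-third σ dp≡2 s<p p<q os op oq)
  ... | tri≈ _ s≡p _ = inj₁ s≡p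
  ... | tri> _ _ p<s with <-cmp s q
  ...   | tri< s<q _ _ = ⊥-elim (dp≡2⇒no-third σ dp≡2 p<s s<q op os oq)
  ...   | tri≈ _ s≡q _ = inj₂ s≡q
  ...   | tri> _ _ q<s = ⊥-elim (dp≡2⇒no-third σ dp≡2 p<q q<s op oq os)

  sameSymbol? : (mu mv : Maybe (SSym G R))
              → Dec (∃[ a ] ((∃[ u ] (mu ≡ just u × ∣ u ∣ₛ ≡ a)) × (∃[ v ] (mv ≡ just v × ∣ v ∣ₛ ≡ a))))
  sameSymbol? nothing  _        = no λ { (_ , (_ , () , _) , _) }
  sameSymbol? (just u) nothing  = no λ { (_ , _ , (_ , () , _)) }
  sameSymbol? (just u) (just v) =
    map′ (λ e → ∣ u ∣ₛ , (u , refl , refl) , (v , refl , sym e))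
         (λ { (_ , (_ , refl , ua) , (_ , refl , va)) → trans ua (sym va) })
         (sym-dec ∣ u ∣ₛ ∣ v ∣ₛ)

  Crossing : Chromosome G R → ℕ → ℕ → Set
  Crossing σ i j = ∃[ p ] ∃[ q ] (i < p × p < j × (q < i ⊎ j < q) × ∃[ a ] (Occ σ p a × Occ σ q a))

  crossing? : ∀ σ i j → Dec (Crossing σ i j)
  crossing? σ i j =
    map′ (λ { (p , _ , q , _ , cr) → p , q , cr })
         (λ { (p , q , cr@(_ , _ , _ , _ , (_ , σp , _) , (_ , σq , _)))
               → p , ‼⇒<length σ σp , q , ‼⇒<length σ σq , cr })
         (anyUpTo? (λ p → anyUpTo? (λ q → (i <? p) ×-dec (p <? j) ×-dec ((q <? i) ⊎-dec (j <? q))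
                                            ×-dec sameSymbol? (σ ‼ p) (σ ‼ q))
                                   (length σ))
                   (length σ))

  crossing⇒neighbour : {π : Chromosome G R} {x : Fin (suc R)} {i j : ℕ} → IsChromosome π → dpMax π ≡ 2
                     → i < j → Occ π i (rep x) → Occ π j (rep x) → Crossing π i j
                     → ∃[ y ] (IsVertex π y × IGAdj π x y)
  crossing⇒neighbour {i = i} {j} cπ max≡2 i<j oi oj (p , q , i<p , p<j , inj₁ q<i , _ , op , oq)
    with twice⇒vertex cπ max≡2 (<-trans q<i i<p) oq op
  ... | y , refl , vy = y , vy , i , j , q , p , oi , oj , oq , op , i<j , <-trans q<i i<p , inj₂ (q<i , i<p , p<j)
  crossing⇒neighbour {i = i} {j} cπ max≡2 i<j oi oj (p , q , i<p , p<j , inj₂ j<q , _ , op , oq)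
    with twice⇒vertex cπ max≡2 (<-trans p<j j<q) op oq
  ... | y , refl , vy = y , vy , i , j , p , q , oi , oj , op , oq , i<j , <-trans p<j j<q , inj₁ (i<p , p<j , j<q)

module Uncrossed {G R : ℕ} {π τ : Chromosome G R}
  (cπ : IsChromosome π) (cτ : IsChromosome τ) (sπ : Simple π) (sτ : Simple τ)
  (same : SameAdjacencies π τ) {x : Fin (suc R)} (vxπ : IsVertex π x) (vxτ : dp (rep x) τ ≡ 2)
  {i j : ℕ} {sx : SSym G R} (i<j : i < j) (πi : π ‼ i ≡ just sx) (πj : π ‼ j ≡ just sx)
  (sx≡x : ∣ sx ∣ₛ ≡ rep x) (uncrossed : ¬ Crossing π i j) where

  r-sx-symbol : proj₁ (r sx) ≡ rep x
  r-sx-symbol = trans (r-symbol sx) sx≡x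

  l-sx-symbol : proj₁ (l sx) ≡ rep x
  l-sx-symbol = trans (l-symbol sx) sx≡x

  sx-at : ∀ {p} → p ≡ i ⊎ p ≡ j → π ‼ p ≡ just sx
  sx-at (inj₁ refl) = πi
  sx-at (inj₂ refl) = πj

  x-in-π : ∀ {q} → Occ π q (rep x) → q ≡ i ⊎ q ≡ j
  x-in-π = dp≡2-positions π vxπ i<j (sx , πi , sx≡x) (sx , πj , sx≡x)

  x-at : ∀ {q a} → Occ π q a → q ≡ i ⊎ q ≡ j → a ≡ rep x
  x-at (_ , πq , ua) q∈ij = trans (sym ua) (trans (cong ∣_∣ₛ (‼-unique π πq (sx-at q∈ij))) sx≡x)

  Inner : Sym G R → Set
  Inner a = ∀ {q} → Occ π q a → i < q × q < j

  confined : ∀ {p a} → i ≤ p → p ≤ j → Occ π p a → a ≢ rep x → Inner a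
  confined {p} i≤p p≤j op a≢x {q} oq with m≤n⇒m<n∨m≡n i≤p | m≤n⇒m<n∨m≡n p≤j
  ... | inj₂ i≡p | _        = ⊥-elim (a≢x (x-at op (inj₁ (sym i≡p))))
  ... | inj₁ _   | inj₂ p≡j = ⊥-elim (a≢x (x-at op (inj₂ p≡j)))
  ... | inj₁ i<p | inj₁ p<j with <-cmp q i
  ...   | tri< q<i _ _ = ⊥-elim (uncrossed (p , q , i<p , p<j , inj₁ q<i , _ , op , oq))
  ...   | tri≈ _ q≡i _ = ⊥-elim (a≢x (x-at oq (inj₁ q≡i)))
  ...   | tri> _ _ i<q with <-cmp q j
  ...     | tri< q<j _ _ = i<q , q<j
  ...     | tri≈ _ q≡j _ = ⊥-elim (a≢x (x-at oq (inj₂ q≡j)))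
  ...     | tri> _ _ j<q = ⊥-elim (uncrossed (p , q , i<p , p<j , inj₂ j<q , _ , op , oq))

  r₀-not-inner : ¬ Inner r₀
  r₀-not-inner inner with inner ((plus , r₀) , chromosome-head cπ , refl)
  ... | () , _

  x-node : ∀ {c q n} → i ≤ c → c < j → NodeAt π c n q → proj₁ n ≡ rep x
         → (q ≡ i × n ≡ r sx) ⊎ (q ≡ j × n ≡ l sx)
  x-node {c} i≤c c<j nd@(r-node πc _ refl) n≡x with x-in-π (subst (Occ π c) n≡x (nodeAt-occ nd))
  ... | inj₁ c≡i = inj₁ (c≡i , cong r (‼-unique π πc (sx-at (inj₁ c≡i))))
  ... | inj₂ c≡j = ⊥-elim (<-irrefl c≡j c<j)
  x-node {c} i≤c c<j nd@(l-node _ πsc refl) n≡x with x-in-π (subst (Occ π (suc c)) n≡x (nodeAt-occ nd))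
  ... | inj₁ 1+c≡i = ⊥-elim (1+n≰n (subst (_≤ c) (sym 1+c≡i) i≤c))
  ... | inj₂ 1+c≡j = inj₂ (1+c≡j , cong l (‼-unique π πsc (sx-at (inj₂ 1+c≡j))))

  Covered : ℕ → Set
  Covered k = ∃[ c ] (i ≤ c × c < j × Matched π τ c k)

  covered-nodes : ∀ {k} → Covered k → ∃[ u ] ∃[ t ] (NodeAt τ k (r u) k × NodeAt τ k (l t) (suc k))
  covered-nodes (_ , _ , _ , matched _ τk _) with adjs-‼⁻ τ τk
  ... | u , t , τk , τsk , _ = u , t , r-node τk τsk refl , l-node τk τsk refl

  inner-node : ∀ {k n q} → Covered k → NodeAt τ k n q → proj₁ n ≢ rep x → Inner (proj₁ n)
  inner-node (c , i≤c , c<j , m) nd n≢x with matched-nodeAt⁻ m nd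
  ... | _ , nd' with nodeAt-position nd'
  ...   | inj₁ refl = confined i≤c (<⇒≤ c<j) (nodeAt-occ nd') n≢x
  ...   | inj₂ refl = confined (m≤n⇒m≤1+n i≤c) c<j (nodeAt-occ nd') n≢x

  inner⇒covered : ∀ {k n q} → NodeAt τ k n q → Inner (proj₁ n) → Covered k
  inner⇒covered nd inner with nodeAt⇒endpoint nd
  ... | _ , τk , _ with sameAdjacencies⇒matchedˡ same τk
  ... | c , m with matched-nodeAt⁻ m nd
  ... | _ , nd' with inner (nodeAt-occ nd') | nodeAt-position nd'
  ... | i<q , q<j | inj₁ refl = c , <⇒≤ i<q , q<j , m
  ... | i<q , q<j | inj₂ refl = c , ≤-pred i<q , <⇒≤ q<j , m

  forward-step : ∀ {k n} → Covered k → NodeAt τ k n (suc k) → proj₁ n ≢ rep x → Covered (suc k)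
  forward-step {k} cov nd@(l-node {t = t} _ τsk refl) n≢x with τ ‼ suc (suc k) in τssk
  ... | nothing = ⊥-elim (r₀-not-inner (subst Inner (cong (λ s → proj₁ (l s)) (chromosome-end cτ τsk τssk))
                                                     (inner-node cov nd n≢x)))
  ... | just _  = inner⇒covered (r-node τsk τssk refl) (subst Inner (l-r-symbol t) (inner-node cov nd n≢x))

  backward-step : ∀ {k n} → Covered k → NodeAt τ k n k → proj₁ n ≢ rep x → ∃[ k₀ ] (k ≡ suc k₀ × Covered k₀)
  backward-step {zero} cov nd@(r-node τ0 _ refl) n≢x =
    ⊥-elim (r₀-not-inner (subst Inner (cong (λ s → proj₁ (r s)) (‼-unique τ τ0 (chromosome-head cτ)))
                                      (inner-node cov nd n≢x)))
  backward-step {suc k} cov nd@(r-node {u} τsk _ refl) n≢x with ‼-defined-≤ τ τsk (n≤1+n k)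
  ... | _ , τk = k , refl , inner⇒covered (l-node τk τsk refl) (subst Inner (sym (l-r-symbol u)) (inner-node cov nd n≢x))

  walk-forward : ∀ fuel {k} → length τ ≤ fuel + k → Covered k
               → ∃[ k' ] ∃[ n ] (k ≤ k' × Covered k' × NodeAt τ k' n (suc k') × proj₁ n ≡ rep x)
  walk-forward fuel {k} len cov with covered-nodes cov
  ... | _ , t , _ , nd with sym-dec (proj₁ (l t)) (rep x)
  ... | yes n≡x = k , l t , ≤-refl , cov , nd , n≡x
  walk-forward zero {k} len cov | _ , _ , _ , l-node _ τsk _ | no _ =
    ⊥-elim (<⇒≱ (‼⇒<length τ τsk) (≤-trans len (n≤1+n k)))
  walk-forward (suc fuel) {k} len cov | _ , _ , _ , nd | no n≢x
    with walk-forward fuel (subst (length τ ≤_) (sym (+-suc fuel k)) len) (forward-step cov nd n≢x)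
  ... | k' , n , 1+k≤k' , rest = k' , n , ≤-trans (n≤1+n k) 1+k≤k' , rest

  walk-backward : ∀ k → Covered k → ∃[ k' ] ∃[ n ] (k' ≤ k × Covered k' × NodeAt τ k' n k' × proj₁ n ≡ rep x)
  walk-backward k cov with covered-nodes cov
  ... | u , _ , nd , _ with sym-dec (proj₁ (r u)) (rep x)
  ... | yes n≡x = k , r u , ≤-refl , cov , nd , n≡x
  ... | no n≢x with backward-step cov nd n≢x
  ...   | k₀ , refl , cov₀ with walk-backward k₀ cov₀
  ...     | k' , n , k'≤k₀ , rest = k' , n , m≤n⇒m≤1+n k'≤k₀ , rest

  x-node-covered : ∀ {k n q} → Covered k → NodeAt τ k n q → proj₁ n ≡ rep x
                 → (Matched π τ i k × n ≡ r sx) ⊎ n ≡ l sx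
  x-node-covered (c , i≤c , c<j , m) nd n≡x with matched-nodeAt⁻ m nd
  ... | _ , nd' with x-node i≤c c<j nd' n≡x | nodeAt-position nd'
  ... | inj₂ (_ , n≡lsx) | _         = inj₂ n≡lsx
  ... | inj₁ (q≡i , n≡rsx) | inj₁ q≡c = inj₁ (subst (λ c → Matched π τ c _) (trans (sym q≡c) q≡i) m , n≡rsx)
  ... | inj₁ (q≡i , _) | inj₂ q≡1+c  = ⊥-elim (1+n≰n (subst (_≤ c) (trans (sym q≡i) q≡1+c) i≤c))

  i≡0⇒sx≡+r₀ : i ≡ 0 → sx ≡ (plus , r₀)
  i≡0⇒sx≡+r₀ i≡0 = ‼-unique π (subst (λ p → π ‼ p ≡ just sx) i≡0 πi) (chromosome-head cπ)

  i≢0 : i ≢ 0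
  i≢0 i≡0 with chromosome-last cπ
  ... | L , 0<L , πL with x-in-π ((minus , r₀) , πL , trans (sym (cong ∣_∣ₛ (i≡0⇒sx≡+r₀ i≡0))) sx≡x)
  ...   | inj₁ L≡i = <-irrefl (sym (trans L≡i i≡0)) 0<L
  ...   | inj₂ L≡j with trans (sym (‼-unique π (sx-at (inj₂ L≡j)) πL)) (i≡0⇒sx≡+r₀ i≡0)
  ...     | ()

  p₀ : ℕ
  p₀ = pred i

  i≡1+p₀ : i ≡ suc p₀
  i≡1+p₀ = sym (suc-pred i {{≢-nonZero i≢0}})

  left-node : NodeAt π p₀ (l sx) i
  left-node with ‼-defined-≤ π πi (subst (p₀ ≤_) (sym i≡1+p₀) (n≤1+n p₀))
  ... | _ , πp₀ = subst (NodeAt π p₀ (l sx)) (sym i≡1+p₀)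
                        (l-node πp₀ (subst (λ p → π ‼ p ≡ just sx) i≡1+p₀ πi) refl)

  right-node : NodeAt π i (r sx) i
  right-node = r-node πi (proj₂ (‼-defined-≤ π πj i<j)) refl

  l-after-i≢r-sx : ∀ {w} → π ‼ suc i ≡ just w → l w ≢ r sx
  l-after-i≢r-sx πsi lw≡rsx with x-node ≤-refl i<j (l-node πi πsi refl) (trans (cong proj₁ lw≡rsx) r-sx-symbol)
  ... | inj₁ (1+i≡i , _)  = 1+n≢n 1+i≡i
  ... | inj₂ (_ , lw≡lsx) = l≢r sx (trans (sym lw≡lsx) lw≡rsx)

  -- The adjacency matched to ⟨r(sx), l(π_{i+1})⟩ has two distinct nodes, so it cannot
  -- contain r(sx) on both sides.
  r-sx-once : ∀ {k} → Matched π τ i k → NodeAt τ k (r sx) k → NodeAt τ k (r sx) (suc k) → ⊥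
  r-sx-once (matched πadj τadj a≈b) (r-node τk _ rsx≡ru) (l-node _ τsk rsx≡lt) with adjs-‼⁻ π πadj
  ... | _ , _ , πi' , πsi , refl with ‼-unique π πi' πi | ‼-unique (adjs τ) τadj (adjs-‼ τ τk τsk)
  ...   | refl | refl = l-after-i≢r-sx πsi (adjEq-loop a≈b (sym rsx≡ru) (sym rsx≡lt))

  other-end : ∀ {k₁ a} → Matched π τ i k₁ → NodeAt τ k₁ (r sx) a
            → ∃[ kb ] ∃[ b ] (Covered kb × NodeAt τ kb (l sx) b × (a < b ⊎ b < a))
  other-end {k₁} m₁ nd-a@(r-node _ _ _) with walk-forward (length τ) (m≤m+n _ _) (i , ≤-refl , i<j , m₁)
  ... | kb , _ , k₁≤kb , covb , nd , n≡x with x-node-covered covb nd n≡x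
  ...   | inj₂ refl = kb , suc kb , covb , nd , inj₁ (s≤s k₁≤kb)
  ...   | inj₁ (mb , refl) with matched-injectiveʳ sτ mb m₁
  ...     | refl = ⊥-elim (r-sx-once m₁ nd-a nd)
  other-end {k₁} m₁ nd-a@(l-node _ _ _) with walk-backward k₁ (i , ≤-refl , i<j , m₁)
  ... | kb , _ , kb≤k₁ , covb , nd , n≡x with x-node-covered covb nd n≡x
  ...   | inj₂ refl = kb , kb , covb , nd , inj₂ (s≤s kb≤k₁)
  ...   | inj₁ (mb , refl) with matched-injectiveʳ sτ mb m₁
  ...     | refl = ⊥-elim (r-sx-once m₁ nd nd-a)

  left-matched : ∀ {a b kb} → (∀ {s} → Occ τ s (rep x) → s ≡ a ⊎ s ≡ b)
               → Covered kb → NodeAt τ kb (l sx) b → LeftMatchedTo π τ i a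
  left-matched x-in-τ (c , i≤c , _ , mc) ndb with nodeAt⇒endpoint left-node
  ... | _ , πp₀ , _ with sameAdjacencies⇒matchedʳ same πp₀
  ... | k₂ , m₂@(matched πadj τadj a≈b) with matched-nodeAt m₂ left-node
  ... | q , nd₂ with x-in-τ (subst (Occ τ q) l-sx-symbol (nodeAt-occ nd₂))
  ...   | inj₁ refl = inj₂ (p₀ , k₂ , _ , _ , i≡1+p₀ , πadj , τadj , a≈b , nodeAt-position nd₂)
  ...   | inj₂ refl with nodeAt-unique-adjacency nd₂ ndb
  ...     | refl with matched-injectiveˡ sπ m₂ mc
  ...       | refl = ⊥-elim (1+n≰n (subst (_≤ p₀) i≡1+p₀ i≤c))

  x-in-τ : ∀ {a b} → a < b ⊎ b < a → Occ τ a (rep x) → Occ τ b (rep x)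
         → ∀ {s} → Occ τ s (rep x) → s ≡ a ⊎ s ≡ b
  x-in-τ (inj₁ a<b) oa ob os = dp≡2-positions τ vxτ a<b oa ob os
  x-in-τ (inj₂ b<a) oa ob os = Sum.swap (dp≡2-positions τ vxτ b<a ob oa os)

  Even : Set
  Even = ∃[ i' ] ∃[ j' ] (i' < j' × Occ τ i' (rep x) × Occ τ j' (rep x) × EvenAt π τ i i' j')

  even : Even
  even with sameAdjacencies⇒matchedʳ same (adjs-‼ π πi (proj₂ (‼-defined-≤ π πj i<j)))
  ... | k₁ , m₁@(matched πadj τadj a≈b) with matched-nodeAt m₁ right-node
  ... | a , nd-a with other-end m₁ nd-a
  ... | _ , b , covb , ndb , a<b⊎b<a = ordered a<b⊎b<a
    where
    oa : Occ τ a (rep x)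
    oa = subst (Occ τ a) r-sx-symbol (nodeAt-occ nd-a)
    ob : Occ τ b (rep x)
    ob = subst (Occ τ b) l-sx-symbol (nodeAt-occ ndb)
    matched-at-a : LeftMatchedTo π τ i a × RightMatchedTo π τ i a
    matched-at-a = left-matched (x-in-τ a<b⊎b<a oa ob) covb ndb
                 , inj₂ (k₁ , _ , _ , πadj , τadj , a≈b , nodeAt-position nd-a)
    ordered : a < b ⊎ b < a → Even
    ordered (inj₁ a<b) = a , b , a<b , oa , ob , inj₁ matched-at-a
    ordered (inj₂ b<a) = b , a , b<a , ob , oa , inj₂ matched-at-a

lemma3 : ∀ {G R : ℕ} (π τ : Chromosome G R)
    → IsChromosome π → IsChromosome τ
    → Simple π → Simple τ
    → Related π τ
    → dpMax π ≡ 2 → dpMax τ ≡ 2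
    → SameAdjacencies π τ
    → ∀ (x : Fin _) → IsVertex π x → White π x → Weight1 π τ x
    → ∃[ y ] (IsVertex π y × IGAdj π x y)
lemma3 π τ cπ cτ sπ sτ rel max≡2 _ same x vx white odd
  with 2≤length-filter⇒∃ (λ s → sym-dec ∣ s ∣ₛ (rep x)) π (≤-reflexive (sym vx))
... | i , j , u , v , i<j , πi , ux , πj , vx'
  with sign-symbol-injective (white i j u v i<j πi πj ux vx') (trans ux (sym vx'))
... | refl with crossing? π i j
...   | yes crossing = crossing⇒neighbour cπ max≡2 i<j (u , πi , ux) (u , πj , ux) crossing
...   | no uncrossed with Uncrossed.even cπ cτ sπ sτ same vx (trans (sym (rel (rep x))) vx) i<j πi πj ux uncrossed
...     | i' , j' , i'<j' , oi' , oj' , ev = ⊥-elim (odd i j i' j' i<j (u , πi , ux) (u , πj , ux) i'<j' oi' oj' ev)
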